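{- Let $\phi=v_1,\ldots,v_n$ be a realizing topological ordering for a degree sequence $\mathcal{S}$ (with realizing dag $D$), and let $1\le i\le n$. Let $\phi'$ be a partial topological ordering for a degree sequence $\mathcal{S}'$ with input potential $0^\Delta$ and output potential $p\in\mathbb{N}^\Delta$ such that $\omega(p)=\omega(p^\phi_i)$ and $p\ge p^\phi_i$. Then $\phi'\phi[i+1,n]$ is a realizing topological ordering for $\mathcal{S}'\uplus\{\binom{d^-(v_{i+1})}{d^+(v_{i+1})},\ldots,\binom{d^-(v_n)}{d^+(v_n)}\}$, where $d^-,d^+$ denote in- and outdegrees in $D$.
   Context: Fix a positive integer $\Delta$; all degrees are at most $\Delta$. A degree sequence is a multiset of pairs $\binom{a}{b}$ of nonnegative integers ($a$ indegree, $b$ outdegree); $\uplus$ is multiset sum. A dag (directed acyclic graph without parallel arcs and self-loops) realizes it if its vertices are in bijection with the elements with matching in/outdegrees. A topological ordering of a dag orders all vertices so that all arcs go forward; a realizing topological ordering for $\mathcal{S}$ is a topological ordering of some dag realizing $\mathcal{S}$; a sequence of elements (vertices with prescribed degrees) is a realizing topological ordering for a degree sequence if there is a dag realizing it with the vertices in that order forming a topological ordering. $\phi[i,j]=v_i,\ldots,v_j$; juxtaposition is concatenation. Potential: for a dag with topological ordering $v_1,\ldots,v_n$ and $0\le i\le n$, $p_i\in\mathbb{N}^\Delta$ with $p_i[l]$ the number of vertices among $v_1,\ldots,v_i$ with at least $l$ neighbors among $v_{i+1},\ldots,v_n$; value $\omega(p)=\sum_{l=1}^\Delta p[l]$; $0^\Delta$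 is the zero vector. For $p,p'\in\mathbb{N}^\Delta$, $p\ge p'$ means $\sum_{l=1}^j p[l]\ge\sum_{l=1}^j p'[l]$ for all $1\le j\le\Delta$. Partial topological ordering: given a degree sequence $\mathcal{S}$ with $n$ elements and $p^s,p^t\in\mathbb{N}^\Delta$, let $P^s$ be a degree sequence of $p^s[1]$ elements of the form $\binom{0}{b}$ such that for each $1\le l\le\Delta$ exactly $p^s[l]$ of them have $b\ge l$, and let $P^t$ consist of $\omega(p^t)$ elements $\binom{1}{0}$. If $\psi$ is a realizing topological ordering for $\mathcal{S}\uplus P^s\uplus P^t$ in which the vertices of $P^s$ come first and those of $P^t$ come last, and the potential at position $p^s[1]+n$ equals $p^t$, then $\psi[p^s[1]+1,p^s[1]+n]$ is a partial topological ordering for $\mathcal{S}$ with input potential $p^s$ and output potential $p^t$. -}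

module Defs where

open import Data.Nat using (ℕ; zero; suc; _+_; _≤_; _<_)
open import Data.Bool using (Bool; true; false; _∨_; T)
open import Data.Fin as Fin using (Fin; toℕ)
open import Data.Product using (_×_; _,_; Σ; ∃; ∃-syntax)
open import Data.List as List using (List; []; _∷_; _++_; length; lookup; allFin; filterᵇ; replicate; take)
open import Data.List.Relation.Unary.All using (All)
open import Data.List.Relation.Binary.Permutation.Propositional using (_↭_)
open import Data.Vec as Vec using (Vec; tabulate; toList)
open import Relation.Binary.PropositionalEquality using (_≡_)
open import Relation.Nullary.Decidable using (⌊_⌋)
open import Data.Nat using (_<ᵇ_; _≤ᵇ_)
import Data.Nat.ListAction as ListAction

-- An element of a degree sequence: (indegree , outdegree).
Deg : Set
Deg = ℕ × ℕ

-- A degree sequence is a multiset, represented by a list (order irrelevant: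
-- all uses go through permutation _↭_).
DegSeq : Set
DegSeq = List Deg

Bounded : ℕ → DegSeq → Set
Bounded Δ S = All (λ d → Data.Product.proj₁ d ≤ Δ × Data.Product.proj₂ d ≤ Δ) S

count : {n : ℕ} → (Fin n → Bool) → ℕ
count {n} f = length (filterᵇ f (allFin n))

-- A dag on vertex set Fin n whose arcs all go forward, i.e. the natural
-- order 0,1,...,n-1 is a topological ordering.  Arcs are a Boolean
-- relation, so there are no parallel arcs; forwardness excludes self-loops
-- and cycles.
record Dag (n : ℕ) : Set where
  field
    arc     : Fin n → Fin n → Bool
    forward : ∀ i j → T (arc i j) → i Fin.< j
open Dag public

indeg : {n : ℕ} → Dag n → Fin n → ℕ
indeg D j = count (λ i → arc D i j)

outdeg : {n : ℕ} → Dag n → Fin n → ℕ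
outdeg D i = count (λ j → arc D i j)

Realizes : (φ : List Deg) → Dag (length φ) → Set
Realizes φ D = ∀ k → lookup φ k ≡ (indeg D k , outdeg D k)

RTO : DegSeq → List Deg → Set
RTO S φ = (φ ↭ S) × Σ (Dag (length φ)) (Realizes φ)

-- Potential p_i of dag D (topological ordering = vertex order) at position i:
-- entry with index l : Fin Δ stands for p_i[l+1] = number of vertices among
-- the first i having at least l+1 neighbours among the vertices after position i.
laterNeighbours : {n : ℕ} → Dag n → ℕ → Fin n → ℕ
laterNeighbours D i k = count (λ j → (i ≤ᵇ toℕ j) Data.Bool.∧ (arc D k j ∨ arc D j k))

potential : (Δ : ℕ) → {n : ℕ} → Dag n → ℕ → Vec ℕ Δ
potential Δ D i = tabulate λ l →
  count (λ k → (toℕ k <ᵇ i) Data.Bool.∧ (toℕ l <ᵇ laterNeighbours D i k))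

ω : {Δ : ℕ} → Vec ℕ Δ → ℕ
ω p = Vec.sum p

zeroV : (Δ : ℕ) → Vec ℕ Δ
zeroV Δ = Vec.replicate Δ 0

prefixSum : {Δ : ℕ} → ℕ → Vec ℕ Δ → ℕ
prefixSum j p = ListAction.sum (take j (toList p))

_≥P_ : {Δ : ℕ} → Vec ℕ Δ → Vec ℕ Δ → Set
_≥P_ {Δ} p p' = ∀ j → 1 ≤ j → j ≤ Δ → prefixSum j p' ≤ prefixSum j p

-- p[1] (first entry; Δ ≥ 1 is assumed wherever this is used)
first : {Δ : ℕ} → Vec ℕ Δ → ℕ
first Vec.[] = 0
first (x Vec.∷ _) = x

countL : {A : Set} → (A → Bool) → List A → ℕ
countL f xs = length (filterᵇ f xs)

IsPs : (Δ : ℕ) → Vec ℕ Δ → DegSeq → Set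
IsPs Δ ps P =
  (length P ≡ first ps)
  × All (λ d → Data.Product.proj₁ d ≡ 0 × Data.Product.proj₂ d ≤ Δ) P
  × (∀ (l : Fin Δ) →
       countL (λ d → toℕ l <ᵇ Data.Product.proj₂ d) P ≡ Vec.lookup ps l)

Pt : {Δ : ℕ} → Vec ℕ Δ → DegSeq
Pt pt = replicate (ω pt) (1 , 0)

PTO : (Δ : ℕ) → DegSeq → Vec ℕ Δ → Vec ℕ Δ → List Deg → Set
PTO Δ S ps pt φ' =
  ∃[ P ] IsPs Δ ps P ×
  ∃[ α ] (α ↭ P) ×
  ((α ++ φ' ++ Pt pt) ↭ (S ++ P ++ Pt pt)) ×
  Σ (Dag (length (α ++ φ' ++ Pt pt))) (λ D →
     Realizes (α ++ φ' ++ Pt pt) D ×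
     potential Δ D (first ps + length S) ≡ pt)

module Submission where

-- The dag for φ'φ[i+1,n] keeps the arcs inside φ' and inside the suffix, and replaces the arcs
-- from v₁,…,vᵢ into the suffix by a bipartite graph from φ' into the suffix. Row x of it needs
-- cₓ arcs (the arcs of x into Pᵗ), and each column the in-arcs its suffix vertex had from
-- v₁,…,vᵢ; the old dag realizes these columns with row sums eₓ (the later neighbours of vₓ).
-- The j-th prefix sum of a potential is Σₓ min(j, cₓ), so ω(p) = ω(pᵢ) and p ≥ pᵢ say exactly
-- that c is majorized by e. A Gale–Ryser greedy argument then builds the bipartite graph:
-- giving each column to the rows of largest remaining demand preserves majorization.

open import Data.Bool using (Bool; true; false; _∧_; _∨_; not; T; if_then_else_)
open import Data.Bool.Properties using (∨-identityʳ; not-involutive; T-≡)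
open import Data.Fin as Fin using (Fin; toℕ; fromℕ<)
open import Data.Fin.Properties using (toℕ<n; fromℕ<-toℕ; toℕ-fromℕ<)
open import Data.List as List using (List; []; _∷_; _++_; length; drop; filterᵇ)
open import Data.List.Membership.Propositional using (_∈_)
open import Data.List.Properties using (length-++; length-drop)
open import Data.List.Relation.Binary.Permutation.Propositional using (_↭_; ↭-trans)
open import Data.List.Relation.Binary.Permutation.Propositional.Properties
  using (++-comm; drop-∷; ↭-length; ++⁺ʳ; ↭-empty-inv; ∈-resp-↭)
open import Data.List.Relation.Unary.All as All using (All)
open import Data.List.Relation.Unary.Any using (here; there)
open import Data.Nat
open import Data.Nat.Properties
open import Algebra.Properties.CommutativeSemigroup +-commutativeSemigroup using (interchange)
open import Data.Product using (_×_; _,_; ∃; proj₁; proj₂)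
open import Data.Sum using (_⊎_; inj₁; inj₂; [_,_]′)
open import Data.Unit using (tt)
open import Data.Vec as Vec using (Vec)
open import Data.Vec.Properties using (lookup∘tabulate)
open import Function using (id)
open import Function.Bundles using (Equivalence)
open import Relation.Binary.PropositionalEquality
open import Relation.Nullary using (yes; no; contradiction)

open import Defs

-- Sums and counts over initial segments of ℕ

∑< : ℕ → (ℕ → ℕ) → ℕ
∑< zero    f = 0
∑< (suc n) f = f 0 + ∑< n (λ x → f (suc x))

syntax ∑< n (λ x → e) = ∑[ x < n ] e

∑<-cong : ∀ n {f g : ℕ → ℕ} → (∀ x → x < n → f x ≡ g x) → ∑< n f ≡ ∑< n g
∑<-cong zero    f≡g = refl
∑<-cong (suc n) f≡g = cong₂ _+_ (f≡g 0 z<s) (∑<-cong n λ x x<n → f≡g (suc x) (s<s x<n))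

∑<-mono-≤ : ∀ n {f g : ℕ → ℕ} → (∀ x → x < n → f x ≤ g x) → ∑< n f ≤ ∑< n g
∑<-mono-≤ zero    f≤g = z≤n
∑<-mono-≤ (suc n) f≤g = +-mono-≤ (f≤g 0 z<s) (∑<-mono-≤ n λ x x<n → f≤g (suc x) (s<s x<n))

∑<-zero : ∀ n {f : ℕ → ℕ} → (∀ x → x < n → f x ≡ 0) → ∑< n f ≡ 0
∑<-zero zero    f≡0 = refl
∑<-zero (suc n) f≡0 = cong₂ _+_ (f≡0 0 z<s) (∑<-zero n λ x x<n → f≡0 (suc x) (s<s x<n))

∑<-+ : ∀ n (f g : ℕ → ℕ) → ∑[ x < n ] (f x + g x) ≡ ∑< n f + ∑< n g
∑<-+ zero    f g = refl
∑<-+ (suc n) f g = trans (cong (f 0 + g 0 +_) (∑<-+ n _ _)) (interchange (f 0) (g 0) _ _)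

∑<-split : ∀ m k (f : ℕ → ℕ) → ∑< (m + k) f ≡ ∑< m f + ∑[ z < k ] f (m + z)
∑<-split zero    k f = refl
∑<-split (suc m) k f = trans (cong (f 0 +_) (∑<-split m k _)) (sym (+-assoc (f 0) _ _))

∑<-split-≤ : ∀ {i n} → i ≤ n → (f : ℕ → ℕ) → ∑< n f ≡ ∑< i f + ∑[ z < n ∸ i ] f (i + z)
∑<-split-≤ {i} i≤n f = trans (cong (λ k → ∑< k f) (sym (m+[n∸m]≡n i≤n))) (∑<-split i _ f)

∑<-swap : ∀ a b (f : ℕ → ℕ → ℕ) → ∑[ x < a ] ∑< b (f x) ≡ ∑[ y < b ] ∑[ x < a ] f x y
∑<-swap zero    b f = sym (∑<-zero b λ _ _ → refl)
∑<-swap (suc a) b f = trans (cong (∑< b (f 0) +_) (∑<-swap a b _)) (sym (∑<-+ b _ _))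

∑<-pointwise-≡ : ∀ n {f g : ℕ → ℕ} → (∀ x → x < n → f x ≤ g x) → ∑< n f ≡ ∑< n g →
                 ∀ x → x < n → f x ≡ g x
∑<-pointwise-≡ (suc n) {f} {g} f≤g f≡g = λ where
    zero    _         → head≡
    (suc x) (s<s x<n) → ∑<-pointwise-≡ n tail≤ (+-cancelˡ-≡ (f 0) _ _ tail≡) x x<n
  where
  tail≤ : ∀ x → x < n → f (suc x) ≤ g (suc x)
  tail≤ x x<n = f≤g (suc x) (s<s x<n)
  head≡ : f 0 ≡ g 0
  head≡ = ≤-antisym (f≤g 0 z<s)
    (+-cancelʳ-≤ _ (g 0) (f 0) (≤-trans (+-monoʳ-≤ (g 0) (∑<-mono-≤ n tail≤)) (≤-reflexive (sym f≡g))))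
  tail≡ : f 0 + ∑< n (λ x → f (suc x)) ≡ f 0 + ∑< n (λ x → g (suc x))
  tail≡ = trans f≡g (cong (_+ _) (sym head≡))

<⇒<ᵇ≡true : ∀ {x y} → x < y → (x <ᵇ y) ≡ true
<⇒<ᵇ≡true {zero}  (s≤s _)   = refl
<⇒<ᵇ≡true {suc x} (s≤s x<y) = <⇒<ᵇ≡true x<y

≥⇒<ᵇ≡false : ∀ {x y} → y ≤ x → (x <ᵇ y) ≡ false
≥⇒<ᵇ≡false z≤n       = refl
≥⇒<ᵇ≡false (s≤s y≤x) = ≥⇒<ᵇ≡false y≤x

≤⇒≤ᵇ≡true : ∀ {x y} → x ≤ y → (x ≤ᵇ y) ≡ true
≤⇒≤ᵇ≡true z≤n       = refl
≤⇒≤ᵇ≡true (s≤s x≤y) = <⇒<ᵇ≡true (s≤s x≤y)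

>⇒≤ᵇ≡false : ∀ {x y} → y < x → (x ≤ᵇ y) ≡ false
>⇒≤ᵇ≡false (s≤s y≤x) = ≥⇒<ᵇ≡false y≤x

<ᵇ≡true⇒< : ∀ {x y} → (x <ᵇ y) ≡ true → x < y
<ᵇ≡true⇒< {x} {y} x<ᵇy = <ᵇ⇒< x y (subst T (sym x<ᵇy) tt)

<ᵇ≡false⇒≥ : ∀ {x y} → (x <ᵇ y) ≡ false → y ≤ x
<ᵇ≡false⇒≥ x≮ᵇy = ≮⇒≥ λ x<y → subst T x≮ᵇy (<⇒<ᵇ x<y)

bit : Bool → ℕ
bit true  = 1
bit false = 0

bit-mono : ∀ {a b} → (a ≡ true → b ≡ true) → bit a ≤ bit b
bit-mono {false}         _   = z≤n
bit-mono {true}  {true}  _   = ≤-refl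
bit-mono {true}  {false} a⇒b = contradiction (a⇒b refl) λ ()

bit-∧ˡ : ∀ a b → bit (a ∧ b) ≤ bit a
bit-∧ˡ true  b = bit-mono {b} λ _ → refl
bit-∧ˡ false b = z≤n

bit-∧ʳ : ∀ a b → bit (a ∧ b) ≤ bit b
bit-∧ʳ true  b = ≤-refl
bit-∧ʳ false b = z≤n

bit-∧-0<ᵇ : ∀ b c → bit (b ∧ (0 <ᵇ c)) ≡ bit b → bit b ≤ c
bit-∧-0<ᵇ false c       _  = z≤n
bit-∧-0<ᵇ true  (suc c) _  = s≤s z≤n
bit-∧-0<ᵇ true  zero    ()

not-∧≡true : ∀ a {b} → not a ∧ b ≡ true → a ≡ false × b ≡ true
not-∧≡true false b≡true = refl , b≡true

count< : ℕ → (ℕ → Bool) → ℕ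
count< n f = ∑[ x < n ] bit (f x)

count<-cong : ∀ n {f g : ℕ → Bool} → (∀ x → x < n → f x ≡ g x) → count< n f ≡ count< n g
count<-cong n f≡g = ∑<-cong n λ x x<n → cong bit (f≡g x x<n)

count<-mono : ∀ n {f g : ℕ → Bool} → (∀ x → x < n → f x ≡ true → g x ≡ true) →
              count< n f ≤ count< n g
count<-mono n f⇒g = ∑<-mono-≤ n λ x x<n → bit-mono (f⇒g x x<n)

count<-none : ∀ n {f : ℕ → Bool} → (∀ x → x < n → f x ≡ false) → count< n f ≡ 0
count<-none n f≡false = ∑<-zero n λ x x<n → cong bit (f≡false x x<n)

count<-all : ∀ n {f : ℕ → Bool} → (∀ x → x < n → f x ≡ true) → count< n f ≡ n
count<-all zero    _      = refl
count<-all (suc n) f≡true rewrite f≡true 0 z<s =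
  cong suc (count<-all n λ x x<n → f≡true (suc x) (s<s x<n))

count<≤ : ∀ n f → count< n f ≤ n
count<≤ n f = ≤-trans (∑<-mono-≤ n λ x _ → bit-mono {f x} {true} λ _ → refl)
                      (≤-reflexive (count<-all n λ _ _ → refl))

count<-∧ˡ : ∀ n (f g : ℕ → Bool) → count< n (λ x → f x ∧ g x) ≤ count< n f
count<-∧ˡ n f g = ∑<-mono-≤ n λ x _ → bit-∧ˡ (f x) (g x)

count<-∧ʳ : ∀ n (f g : ℕ → Bool) → count< n (λ x → f x ∧ g x) ≤ count< n g
count<-∧ʳ n f g = ∑<-mono-≤ n λ x _ → bit-∧ʳ (f x) (g x)

count<-below : ∀ {i n} → i ≤ n → (f : ℕ → Bool) → count< n (λ x → (x <ᵇ i) ∧ f x) ≡ count< i f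
count<-below {i} {n} i≤n f = begin
  count< n (λ x → (x <ᵇ i) ∧ f x)
    ≡⟨ ∑<-split-≤ i≤n _ ⟩
  count< i (λ x → (x <ᵇ i) ∧ f x) + count< (n ∸ i) (λ z → (i + z <ᵇ i) ∧ f (i + z))
    ≡⟨ cong₂ _+_ (count<-cong i λ x x<i → cong (_∧ f x) (<⇒<ᵇ≡true x<i))
                 (count<-none (n ∸ i) λ z _ → cong (_∧ f (i + z)) (≥⇒<ᵇ≡false (m≤m+n i z))) ⟩
  count< i f + 0
    ≡⟨ +-identityʳ _ ⟩
  count< i f ∎
  where open ≡-Reasoning

insert : (ℕ → Bool) → ℕ → ℕ → Bool
insert f y x = (x ≡ᵇ y) ∨ f x

count<-insert : ∀ n (f : ℕ → Bool) {y} → y < n → f y ≡ false → count< n (insert f y) ≡ suc (count< n f)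
count<-insert (suc n) f {zero}  _         f0≡false rewrite f0≡false = refl
count<-insert (suc n) f {suc y} (s<s y<n) fy≡false =
  trans (cong (bit (f 0) +_) (count<-insert n (λ x → f (suc x)) y<n fy≡false)) (+-suc (bit (f 0)) _)

search : ∀ n (P : ℕ → Bool) → (∀ x → x < n → P x ≡ false) ⊎ ∃ λ x → x < n × P x ≡ true
search zero    P = inj₁ λ _ ()
search (suc n) P with P 0 in P0 | search n (λ x → P (suc x))
... | true  | _                   = inj₂ (0 , z<s , P0)
... | false | inj₂ (x , x<n , Px) = inj₂ (suc x , s<s x<n , Px)
... | false | inj₁ none           = inj₁ λ where
  zero    _         → P0
  (suc x) (s<s x<n) → none x x<n

-- Majorization and the greedy bipartite construction

maximum : ∀ n (P : ℕ → Bool) (c : ℕ → ℕ) →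
  (∀ x → x < n → P x ≡ false) ⊎
  ∃ λ y → y < n × P y ≡ true × (∀ x → x < n → P x ≡ true → c x ≤ c y)
maximum zero    P c = inj₁ λ _ ()
maximum (suc n) P c with P 0 in P0 | maximum n (λ x → P (suc x)) (λ x → c (suc x))
... | false | inj₁ none = inj₁ λ where
  zero    _         → P0
  (suc x) (s<s x<n) → none x x<n
... | false | inj₂ (y , y<n , Py , max) = inj₂ (suc y , s<s y<n , Py , λ where
  zero    _         P0≡true → contradiction (trans (sym P0≡true) P0) λ ()
  (suc x) (s<s x<n) Px      → max x x<n Px)
... | true | inj₁ none = inj₂ (0 , z<s , P0 , λ where
  zero    _         _  → ≤-refl
  (suc x) (s<s x<n) Px → contradiction (trans (sym Px) (none x x<n)) λ ())
... | true | inj₂ (y , y<n , Py , max) with c 0 ≤? c (suc y)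
...   | yes c0≤cy = inj₂ (suc y , s<s y<n , Py , λ where
  zero    _         _  → c0≤cy
  (suc x) (s<s x<n) Px → max x x<n Px)
...   | no c0≰cy = inj₂ (0 , z<s , P0 , λ where
  zero    _         _  → ≤-refl
  (suc x) (s<s x<n) Px → ≤-trans (max x x<n Px) (<⇒≤ (≰⇒> c0≰cy)))

TopRows : ℕ → (ℕ → ℕ) → (ℕ → Bool) → Set
TopRows m c M = ∀ x y → x < m → y < m → M x ≡ false → M y ≡ true → c x ≤ c y

topRows : ∀ m (c : ℕ → ℕ) r → r ≤ m → ∃ λ (M : ℕ → Bool) → count< m M ≡ r × TopRows m c M
topRows m c zero    _   = (λ _ → false) , count<-none m (λ _ _ → refl) , λ _ _ _ _ _ ()
topRows m c (suc r) r<m with topRows m c r (<⇒≤ r<m)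
... | M , |M|≡r , top with maximum m (λ x → not (M x)) c
...   | inj₁ full = contradiction (trans (sym |M|≡r) (count<-all m λ x x<m → M≡true (full x x<m))) (<⇒≢ r<m)
  where
  M≡true : ∀ {x} → not (M x) ≡ false → M x ≡ true
  M≡true {x} ¬M≡false = trans (sym (not-involutive (M x))) (cong not ¬M≡false)
...   | inj₂ (y , y<m , ¬My , max) =
  insert M y , trans (count<-insert m M y<m My≡false) (cong suc |M|≡r) , top′
  where
  My≡false : M y ≡ false
  My≡false = trans (sym (not-involutive (M y))) (cong not ¬My)
  ∉-insert : ∀ x → insert M y x ≡ false → M x ≡ false
  ∉-insert x x∉ with x ≡ᵇ y
  ... | false = x∉
  top′ : TopRows m c (insert M y)
  top′ x y′ x<m y′<m x∉ y′∈ with y′ ≡ᵇ y in y′≡ᵇy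
  ... | true rewrite ≡ᵇ⇒≡ y′ y (subst T (sym y′≡ᵇy) tt) = max x x<m (cong not (∉-insert x x∉))
  ... | false = top x y′ x<m y′<m (∉-insert x x∉) y′∈

above : ℕ → (ℕ → ℕ) → ℕ → ℕ
above m c j = count< m (λ x → j <ᵇ c x)

topRows-threshold : ∀ m (c : ℕ → ℕ) (M : ℕ → Bool) → TopRows m c M → ∀ j →
  count< m M ≤ count< m (λ x → M x ∧ (j <ᵇ c x)) ⊎ above m c j ≤ count< m (λ x → M x ∧ (j <ᵇ c x))
topRows-threshold m c M top j with search m (λ x → not (M x) ∧ (j <ᵇ c x))
... | inj₁ none = inj₂ (count<-mono m above⇒M)
  where
  above⇒M : ∀ x → x < m → (j <ᵇ c x) ≡ true → M x ∧ (j <ᵇ c x) ≡ true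
  above⇒M x x<m j<c with M x | none x x<m
  ... | true  | _   = j<c
  ... | false | j≮c = contradiction (trans (sym j<c) j≮c) λ ()
... | inj₂ (x , x<m , w) with not-∧≡true (M x) w
...   | Mx≡false , j<ᵇcx = inj₁ (count<-mono m M⇒above)
  where
  M⇒above : ∀ y → y < m → M y ≡ true → M y ∧ (j <ᵇ c y) ≡ true
  M⇒above y y<m My rewrite My =
    <⇒<ᵇ≡true (<-≤-trans (<ᵇ≡true⇒< j<ᵇcx) (top x y x<m y<m Mx≡false My))

excess : ℕ → (ℕ → ℕ) → ℕ → ℕ
excess m c j = ∑[ x < m ] (c x ∸ j)

capped : ℕ → (ℕ → ℕ) → ℕ → ℕ
capped m c j = ∑[ x < m ] (j ⊓ c x)

∸-step : ∀ c j → c ∸ j ≡ c ∸ suc j + bit (j <ᵇ c)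
∸-step zero    j       = 0∸n≡0 j
∸-step (suc c) zero    = +-comm 1 c
∸-step (suc c) (suc j) = ∸-step c j

∸-bit-step : ∀ c b j → (c ∸ bit b) ∸ j + bit (b ∧ (j <ᵇ c)) ≡ c ∸ j
∸-bit-step c       false j = +-identityʳ _
∸-bit-step zero    true  j = +-identityʳ _
∸-bit-step (suc c) true  j = sym (∸-step (suc c) j)

∑<-bit-<ᵇ : ∀ j e → ∑[ l < j ] bit (l <ᵇ e) ≡ j ⊓ e
∑<-bit-<ᵇ zero    e       = refl
∑<-bit-<ᵇ (suc j) zero    = ∑<-zero j λ _ _ → refl
∑<-bit-<ᵇ (suc j) (suc e) = cong suc (∑<-bit-<ᵇ j e)

excess-step : ∀ m (c : ℕ → ℕ) j → excess m c j ≡ excess m c (suc j) + above m c j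
excess-step m c j = trans (∑<-cong m λ x _ → ∸-step (c x) j) (∑<-+ m _ _)

excess-remove : ∀ m (c : ℕ → ℕ) (M : ℕ → Bool) j →
  excess m (λ x → c x ∸ bit (M x)) j + count< m (λ x → M x ∧ (j <ᵇ c x)) ≡ excess m c j
excess-remove m c M j = trans (sym (∑<-+ m _ _)) (∑<-cong m λ x _ → ∸-bit-step (c x) (M x) j)

capped+excess : ∀ m (c : ℕ → ℕ) j → capped m c j + excess m c j ≡ ∑< m c
capped+excess m c j = trans (sym (∑<-+ m _ _)) (∑<-cong m λ x _ → m⊓n+n∸m≡n j (c x))

capped-bounded : ∀ {Δ} m {c} → (∀ x → x < m → c x ≤ Δ) → capped m c Δ ≡ ∑< m c
capped-bounded m c≤Δ = ∑<-cong m λ x x<m → m≥n⇒m⊓n≡n (c≤Δ x x<m)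

∑<-above : ∀ m (c : ℕ → ℕ) j → ∑< j (above m c) ≡ capped m c j
∑<-above m c j = trans (∑<-swap j m _) (∑<-cong m λ x _ → ∑<-bit-<ᵇ j (c x))

-- (cₓ)ₓ₍<m₎ is majorized by (eₓ)ₓ₍<k₎, in the form Σₓ (cₓ ∸ j) ≤ Σₓ (eₓ ∸ j) for all j.
record Majorized (m : ℕ) (c : ℕ → ℕ) (k : ℕ) (e : ℕ → ℕ) : Set where
  field
    total    : ∑< m c ≡ ∑< k e
    excess-≤ : ∀ j → excess m c j ≤ excess k e j
open Majorized

Majorized-congʳ : ∀ {m k c e e′} → (∀ x → x < k → e x ≡ e′ x) →
                  Majorized m c k e → Majorized m c k e′
Majorized-congʳ {k = k} e≡e′ maj = record
  { total    = trans (total maj) (∑<-cong k e≡e′)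
  ; excess-≤ = λ j → ≤-trans (excess-≤ maj j)
                             (≤-reflexive (∑<-cong k λ x x<k → cong (_∸ j) (e≡e′ x x<k)))
  }

capped-≥⇒majorized : ∀ {Δ m k c e} → (∀ x → x < m → c x ≤ Δ) → (∀ x → x < k → e x ≤ Δ) →
  capped m c Δ ≡ capped k e Δ → (∀ j → 1 ≤ j → j ≤ Δ → capped k e j ≤ capped m c j) →
  Majorized m c k e
capped-≥⇒majorized {Δ} {m} {k} {c} {e} c≤Δ e≤Δ capΔ≡ cap≥ =
  record { total = total′ ; excess-≤ = excess-≤′ }
  where
  total′ : ∑< m c ≡ ∑< k e
  total′ = trans (sym (capped-bounded m c≤Δ)) (trans capΔ≡ (capped-bounded k e≤Δ))
  excess-≤′ : ∀ j → excess m c j ≤ excess k e j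
  excess-≤′ zero = ≤-reflexive total′
  excess-≤′ (suc j) with suc j ≤? Δ
  ... | yes j<Δ = +-cancelˡ-≤ (capped m c (suc j)) _ _ (begin
    capped m c (suc j) + excess m c (suc j) ≡⟨ capped+excess m c (suc j) ⟩
    ∑< m c                                  ≡⟨ total′ ⟩
    ∑< k e                                  ≡⟨ sym (capped+excess k e (suc j)) ⟩
    capped k e (suc j) + excess k e (suc j) ≤⟨ +-monoˡ-≤ _ (cap≥ (suc j) (s≤s z≤n) j<Δ) ⟩
    capped m c (suc j) + excess k e (suc j) ∎)
    where open ≤-Reasoning
  ... | no j≮Δ = subst (_≤ _) (sym (∑<-zero m λ x x<m → m≤n⇒m∸n≡0 (≤-trans (c≤Δ x x<m) (<⇒≤ (≰⇒> j≮Δ))))) z≤n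

majorized-above₀ : ∀ {m k c e} → Majorized m c k e → above k e 0 ≤ above m c 0
majorized-above₀ {m} {k} {c} {e} maj = +-cancelˡ-≤ (excess k e 1) _ _ (begin
  excess k e 1 + above k e 0 ≡⟨ sym (excess-step k e 0) ⟩
  excess k e 0               ≡⟨ sym (total maj) ⟩
  excess m c 0               ≡⟨ excess-step m c 0 ⟩
  excess m c 1 + above m c 0 ≤⟨ +-monoˡ-≤ _ (excess-≤ maj 1) ⟩
  excess k e 1 + above m c 0 ∎)
  where open ≤-Reasoning

-- One greedy step: the first column N of a matrix whose row sums 1ᴺ + e majorize c is given to
-- the rows of largest demand; the remaining demand is still majorized by e.
module _ {m k : ℕ} {c : ℕ → ℕ} (N : ℕ → Bool) (e : ℕ → ℕ)
         (maj : Majorized m c k (λ x → bit (N x) + e x)) where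
  private
    e⁺ : ℕ → ℕ
    e⁺ x = bit (N x) + e x
    r : ℕ
    r = count< k N
    b : ℕ → ℕ
    b j = count< k (λ x → N x ∧ (j <ᵇ e⁺ x))

    b₀≡r : b 0 ≡ r
    b₀≡r = count<-cong k λ x _ → n∧0< (N x) (e x)
      where
      n∧0< : ∀ n d → n ∧ (0 <ᵇ bit n + d) ≡ n
      n∧0< true  _ = refl
      n∧0< false _ = refl

    r≤above₀ : r ≤ above m c 0
    r≤above₀ = begin
      r           ≡⟨ sym b₀≡r ⟩
      b 0         ≤⟨ count<-∧ʳ k N _ ⟩
      above k e⁺ 0 ≤⟨ majorized-above₀ maj ⟩
      above m c 0 ∎
      where open ≤-Reasoning

    top : ∃ λ (M : ℕ → Bool) → count< m M ≡ r × TopRows m c M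
    top = topRows m c r (≤-trans r≤above₀ (count<≤ m _))
    M : ℕ → Bool
    M = proj₁ top
    |M|≡r : count< m M ≡ r
    |M|≡r = proj₁ (proj₂ top)
    c⁻ : ℕ → ℕ
    c⁻ x = c x ∸ bit (M x)
    a : ℕ → ℕ
    a j = count< m (λ x → M x ∧ (j <ᵇ c x))

    a-cases : ∀ j → r ≤ a j ⊎ above m c j ≤ a j
    a-cases j = subst (λ s → s ≤ a j ⊎ above m c j ≤ a j) |M|≡r
                      (topRows-threshold m c M (proj₂ (proj₂ top)) j)

    a₀≡|M| : a 0 ≡ count< m M
    a₀≡|M| = ≤-antisym (count<-∧ˡ m M _)
      (subst (_≤ a 0) (sym |M|≡r) ([ id , ≤-trans r≤above₀ ]′ (a-cases 0)))

    M≤c : ∀ x → x < m → bit (M x) ≤ c x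
    M≤c x x<m = bit-∧-0<ᵇ (M x) (c x) (∑<-pointwise-≡ m (λ y _ → bit-∧ˡ (M y) _) a₀≡|M| x x<m)

    removeM : ∀ j → excess m c⁻ j + a j ≡ excess m c j
    removeM = excess-remove m c M

    removeN : ∀ j → excess k e j + b j ≡ excess k e⁺ j
    removeN j = trans (cong (_+ b j) (∑<-cong k λ x _ → cong (_∸ j) (sym (m+n∸m≡n (bit (N x)) (e x)))))
                      (excess-remove k e⁺ N j)

    total′ : ∑< m c⁻ ≡ ∑< k e
    total′ = +-cancelʳ-≡ r _ _ (begin
      excess m c⁻ 0 + r   ≡⟨ cong (excess m c⁻ 0 +_) (sym (trans a₀≡|M| |M|≡r)) ⟩
      excess m c⁻ 0 + a 0 ≡⟨ removeM 0 ⟩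
      excess m c 0        ≡⟨ total maj ⟩
      excess k e⁺ 0       ≡⟨ sym (removeN 0) ⟩
      excess k e 0 + b 0  ≡⟨ cong (excess k e 0 +_) b₀≡r ⟩
      excess k e 0 + r    ∎)
      where open ≡-Reasoning

    -- If all of M lies above j, removing M lowers the excess at j by r ≥ b j; otherwise every row
    -- above j lost one unit, and the excess at j falls to the old excess at j + 1.
    excess-≤′ : ∀ j → excess m c⁻ j ≤ excess k e j
    excess-≤′ j with a-cases j
    ... | inj₁ r≤aj = +-cancelʳ-≤ (a j) _ _ (begin
      excess m c⁻ j + a j ≡⟨ removeM j ⟩
      excess m c j        ≤⟨ excess-≤ maj j ⟩
      excess k e⁺ j       ≡⟨ sym (removeN j) ⟩
      excess k e j + b j  ≤⟨ +-monoʳ-≤ _ (≤-trans (count<-∧ˡ k N _) r≤aj) ⟩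
      excess k e j + a j  ∎)
      where open ≤-Reasoning
    ... | inj₂ above≤aj = +-cancelʳ-≤ (a j) _ _ (begin
      excess m c⁻ j + a j                ≡⟨ removeM j ⟩
      excess m c j                       ≡⟨ excess-step m c j ⟩
      excess m c (suc j) + above m c j   ≤⟨ +-mono-≤ (excess-≤ maj (suc j)) above≤aj ⟩
      excess k e⁺ (suc j) + a j          ≤⟨ +-monoˡ-≤ (a j) e⁺-step ⟩
      excess k e j + a j                 ∎)
      where
      open ≤-Reasoning
      e⁺-step : excess k e⁺ (suc j) ≤ excess k e j
      e⁺-step = +-cancelʳ-≤ (above k e⁺ j) _ _ (begin
        excess k e⁺ (suc j) + above k e⁺ j ≡⟨ sym (excess-step k e⁺ j) ⟩
        excess k e⁺ j                      ≡⟨ sym (removeN j) ⟩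
        excess k e j + b j                 ≤⟨ +-monoʳ-≤ _ (count<-∧ʳ k N _) ⟩
        excess k e j + above k e⁺ j        ∎)

  peelColumn : ∃ λ (M : ℕ → Bool) → count< m M ≡ count< k N
                                  × (∀ x → x < m → bit (M x) ≤ c x)
                                  × Majorized m (λ x → c x ∸ bit (M x)) k e
  peelColumn = M , |M|≡r , M≤c , record { total = total′ ; excess-≤ = excess-≤′ }

realize-majorized : ∀ t {m k c} (A : ℕ → ℕ → Bool) → Majorized m c k (λ x → count< t (A x)) →
  ∃ λ (B : ℕ → ℕ → Bool) → (∀ x → x < m → count< t (B x) ≡ c x)
        × (∀ z → z < t → count< m (λ x → B x z) ≡ count< k (λ x → A x z))
realize-majorized zero {m} {k} {c} A maj = (λ _ _ → false) , c≡0 , λ _ ()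
  where
  c≡0 : ∀ x → x < m → 0 ≡ c x
  c≡0 = ∑<-pointwise-≡ m (λ _ _ → z≤n)
          (trans (∑<-zero m λ _ _ → refl) (trans (sym (∑<-zero k λ _ _ → refl)) (sym (total maj))))
realize-majorized (suc t) {m} {k} {c} A maj
  with peelColumn (λ x → A x 0) (λ x → count< t (λ z → A x (suc z))) maj
... | M , |M| , M≤c , maj′ with realize-majorized t (λ x z → A x (suc z)) maj′
... | B , rows , cols = B′ , rows′ , cols′
  where
  B′ : ℕ → ℕ → Bool
  B′ x zero    = M x
  B′ x (suc z) = B x z
  rows′ : ∀ x → x < m → count< (suc t) (B′ x) ≡ c x
  rows′ x x<m = trans (cong (bit (M x) +_) (rows x x<m)) (m+[n∸m]≡n (M≤c x x<m))
  cols′ : ∀ z → z < suc t → count< m (λ x → B′ x z) ≡ count< k (λ x → A x z)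
  cols′ zero    _         = |M|
  cols′ (suc z) (s<s z<t) = cols z z<t

-- Degrees and potentials of dags on ℕ-indices

entry : List Deg → ℕ → Deg
entry []       _       = 0 , 0
entry (d ∷ _)  zero    = d
entry (_ ∷ ds) (suc x) = entry ds x

lookup≡entry : ∀ (L : List Deg) k → List.lookup L k ≡ entry L (toℕ k)
lookup≡entry (_ ∷ _)  Fin.zero    = refl
lookup≡entry (_ ∷ ds) (Fin.suc k) = lookup≡entry ds k

entry-++ˡ : ∀ (L L′ : List Deg) {x} → x < length L → entry (L ++ L′) x ≡ entry L x
entry-++ˡ (_ ∷ _)  L′ {zero}  _         = refl
entry-++ˡ (_ ∷ ds) L′ {suc x} (s<s x<n) = entry-++ˡ ds L′ x<n

entry-++ʳ : ∀ (L L′ : List Deg) z → entry (L ++ L′) (length L + z) ≡ entry L′ z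
entry-++ʳ []       L′ z = refl
entry-++ʳ (_ ∷ ds) L′ z = entry-++ʳ ds L′ z

entry-drop : ∀ i (L : List Deg) z → entry (drop i L) z ≡ entry L (i + z)
entry-drop zero    L        z = refl
entry-drop (suc i) []       z = refl
entry-drop (suc i) (_ ∷ ds) z = entry-drop i ds z

entry-∈ : ∀ (L : List Deg) {x} → x < length L → entry L x ∈ L
entry-∈ (_ ∷ _)  {zero}  _         = here refl
entry-∈ (_ ∷ ds) {suc x} (s<s x<n) = there (entry-∈ ds x<n)

Bounded⇒outdegree≤ : ∀ {Δ S L} → Bounded Δ S → L ↭ S →
                     ∀ {x} → x < length L → proj₂ (entry L x) ≤ Δ
Bounded⇒outdegree≤ bounded L↭S {x} x<n = proj₂ (All.lookup bounded (∈-resp-↭ L↭S (entry-∈ _ x<n)))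

++-cancelˡ : ∀ {A : Set} (zs : List A) {xs ys} → zs ++ xs ↭ zs ++ ys → xs ↭ ys
++-cancelˡ []       p = p
++-cancelˡ (_ ∷ zs) p = ++-cancelˡ zs (drop-∷ p)

++-cancelʳ : ∀ {A : Set} (zs : List A) {xs ys} → xs ++ zs ↭ ys ++ zs → xs ↭ ys
++-cancelʳ zs {xs} {ys} p = ++-cancelˡ zs (↭-trans (++-comm zs xs) (↭-trans p (++-comm ys zs)))

length-filterᵇ-tabulate : ∀ {A : Set} n (h : Fin n → A) (f : A → Bool) (g : ℕ → Bool) →
  (∀ k → f (h k) ≡ g (toℕ k)) → length (filterᵇ f (List.tabulate h)) ≡ count< n g
length-filterᵇ-tabulate zero    h f g f≡g = refl
length-filterᵇ-tabulate (suc n) h f g f≡g with f (h Fin.zero) | f≡g Fin.zero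
... | true  | f₀≡g₀ rewrite sym f₀≡g₀ = cong suc (length-filterᵇ-tabulate n _ f _ λ k → f≡g (Fin.suc k))
... | false | f₀≡g₀ rewrite sym f₀≡g₀ = length-filterᵇ-tabulate n _ f _ λ k → f≡g (Fin.suc k)

count≡count< : ∀ {n} (f : Fin n → Bool) (g : ℕ → Bool) →
               (∀ k → f k ≡ g (toℕ k)) → count f ≡ count< n g
count≡count< {n} f g = length-filterᵇ-tabulate n id f g

Forward : (ℕ → ℕ → Bool) → Set
Forward A = ∀ x y → A x y ≡ true → x < y

Forward⇒no-backward-arc : ∀ {A} → Forward A → ∀ {x y} → y ≤ x → A x y ≡ false
Forward⇒no-backward-arc {A} fwd {x} {y} y≤x with A x y in Axy
... | false = refl
... | true  = contradiction (fwd x y Axy) (≤⇒≯ y≤x)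

laterℕ : ℕ → (ℕ → ℕ → Bool) → ℕ → ℕ → ℕ
laterℕ n A i x = count< n (λ y → (i ≤ᵇ y) ∧ (A x y ∨ A y x))

module _ {n : ℕ} {A : ℕ → ℕ → Bool} (fwd : Forward A) {i : ℕ} (i≤n : i ≤ n) where
  laterℕ≡forwardArcs : ∀ {x} → x < i → laterℕ n A i x ≡ count< (n ∸ i) (λ z → A x (i + z))
  laterℕ≡forwardArcs {x} x<i = trans (∑<-split-≤ i≤n _) (cong₂ _+_
    (count<-none i λ y y<i → cong (_∧ _) (>⇒≤ᵇ≡false y<i))
    (count<-cong (n ∸ i) λ z _ → arc-to-later z))
    where
    arc-to-later : ∀ z → (i ≤ᵇ i + z) ∧ (A x (i + z) ∨ A (i + z) x) ≡ A x (i + z)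
    arc-to-later z
      rewrite ≤⇒≤ᵇ≡true (m≤m+n i z) | Forward⇒no-backward-arc fwd (≤-trans (<⇒≤ x<i) (m≤m+n i z)) =
      ∨-identityʳ _

  outdegree-split : ∀ {x} → x < i → count< n (A x) ≡ count< i (A x) + laterℕ n A i x
  outdegree-split x<i = trans (∑<-split-≤ i≤n _) (cong (count< i _ +_) (sym (laterℕ≡forwardArcs x<i)))

module _ {n : ℕ} (D : Dag n) where
  arcℕ : ℕ → ℕ → Bool
  arcℕ x y with x <? n | y <? n
  ... | yes x<n | yes y<n = arc D (fromℕ< x<n) (fromℕ< y<n)
  ... | _       | _       = false

  arcℕ-toℕ : ∀ k j → arcℕ (toℕ k) (toℕ j) ≡ arc D k j
  arcℕ-toℕ k j with toℕ k <? n | toℕ j <? n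
  ... | yes k<n | yes j<n rewrite fromℕ<-toℕ k k<n | fromℕ<-toℕ j j<n = refl
  ... | no k≮n  | _       = contradiction (toℕ<n k) k≮n
  ... | yes _   | no j≮n  = contradiction (toℕ<n j) j≮n

  arcℕ-forward : Forward arcℕ
  arcℕ-forward x y arc≡true with x <? n | y <? n
  ... | yes x<n | yes y<n =
    subst₂ _<_ (toℕ-fromℕ< x<n) (toℕ-fromℕ< y<n) (forward D _ _ (subst T (sym arc≡true) tt))

  later : ℕ → ℕ → ℕ
  later = laterℕ n arcℕ

  laterNeighbours≡later : ∀ i k → laterNeighbours D i k ≡ later i (toℕ k)
  laterNeighbours≡later i k = count≡count< _ _ λ j →
    cong₂ (λ a b → (i ≤ᵇ toℕ j) ∧ (a ∨ b)) (sym (arcℕ-toℕ k j)) (sym (arcℕ-toℕ j k))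

  potential-lookup : ∀ Δ {i} → i ≤ n → (l : Fin Δ) →
                     Vec.lookup (potential Δ D i) l ≡ above i (later i) (toℕ l)
  potential-lookup Δ {i} i≤n l = begin
    Vec.lookup (potential Δ D i) l
      ≡⟨ lookup∘tabulate _ l ⟩
    count (λ k → (toℕ k <ᵇ i) ∧ (toℕ l <ᵇ laterNeighbours D i k))
      ≡⟨ count≡count< _ _ (λ k →
           cong (λ v → (toℕ k <ᵇ i) ∧ (toℕ l <ᵇ v)) (laterNeighbours≡later i k)) ⟩
    count< n (λ x → (x <ᵇ i) ∧ (toℕ l <ᵇ later i x))
      ≡⟨ count<-below i≤n _ ⟩
    above i (later i) (toℕ l) ∎
    where open ≡-Reasoning

RealizesBy : List Deg → (ℕ → ℕ → Bool) → Set
RealizesBy L A = ∀ x → x < length L → entry L x ≡ (count< (length L) (λ y → A y x) , count< (length L) (A x))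

Realizes⇒RealizesBy : ∀ L (D : Dag (length L)) → Realizes L D → RealizesBy L (arcℕ D)
Realizes⇒RealizesBy L D real x x<n = begin
  entry L x
    ≡⟨ cong (entry L) (sym (toℕ-fromℕ< x<n)) ⟩
  entry L (toℕ k)
    ≡⟨ sym (lookup≡entry L k) ⟩
  List.lookup L k
    ≡⟨ real k ⟩
  (indeg D k , outdeg D k)
    ≡⟨ cong₂ _,_ (count≡count< _ _ λ j → sym (arcℕ-toℕ D j k))
                 (count≡count< _ _ λ j → sym (arcℕ-toℕ D k j)) ⟩
  (count< (length L) (λ y → arcℕ D y (toℕ k)) , count< (length L) (arcℕ D (toℕ k)))
    ≡⟨ cong (λ v → count< (length L) (λ y → arcℕ D y v) , count< (length L) (arcℕ D v))
            (toℕ-fromℕ< x<n) ⟩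
  (count< (length L) (λ y → arcℕ D y x) , count< (length L) (arcℕ D x)) ∎
  where
  open ≡-Reasoning
  k = fromℕ< x<n

dagℕ : ∀ n (A : ℕ → ℕ → Bool) → Forward A → Dag n
dagℕ n A fwd = record
  { arc     = λ k j → A (toℕ k) (toℕ j)
  ; forward = λ k j arc → fwd (toℕ k) (toℕ j) (Equivalence.to T-≡ arc)
  }

RealizesBy⇒Realizes : ∀ L (A : ℕ → ℕ → Bool) (fwd : Forward A) →
                       RealizesBy L A → Realizes L (dagℕ (length L) A fwd)
RealizesBy⇒Realizes L A fwd real k = trans (lookup≡entry L k) (trans (real (toℕ k) (toℕ<n k))
  (sym (cong₂ _,_ (count≡count< {length L} _ (λ y → A y (toℕ k)) λ _ → refl)
                  (count≡count< {length L} _ (A (toℕ k)) λ _ → refl))))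

later-≤-outdegree : ∀ L (D : Dag (length L)) → Realizes L D → ∀ {i x} → i ≤ length L → x < i →
                    later D i x ≤ proj₂ (entry L x)
later-≤-outdegree L D real {i} {x} i≤n x<i = begin
  later D i x                          ≤⟨ m≤n+m _ _ ⟩
  count< i (arcℕ D x) + later D i x   ≡⟨ sym (outdegree-split (arcℕ-forward D) i≤n x<i) ⟩
  count< (length L) (arcℕ D x)        ≡⟨ cong proj₂ (sym (Realizes⇒RealizesBy L D real x (<-≤-trans x<i i≤n))) ⟩
  proj₂ (entry L x)                    ∎
  where open ≤-Reasoning

prefixSum-lookup : ∀ {Δ} j (v : Vec ℕ Δ) (g : ℕ → ℕ) → (∀ l → Vec.lookup v l ≡ g (toℕ l)) → j ≤ Δ →
                   prefixSum j v ≡ ∑< j g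
prefixSum-lookup zero    v              g v≡g _         = refl
prefixSum-lookup (suc j) (x Vec.∷ v) g v≡g (s≤s j≤Δ) =
  cong₂ _+_ (v≡g Fin.zero) (prefixSum-lookup j v (λ l → g (suc l)) (λ l → v≡g (Fin.suc l)) j≤Δ)

ω≡prefixSum : ∀ {Δ} (v : Vec ℕ Δ) → ω v ≡ prefixSum Δ v
ω≡prefixSum Vec.[]       = refl
ω≡prefixSum (x Vec.∷ v) = cong (x +_) (ω≡prefixSum v)

prefixSum-potential : ∀ Δ {n} (D : Dag n) {i j} → i ≤ n → j ≤ Δ →
                      prefixSum j (potential Δ D i) ≡ capped i (later D i) j
prefixSum-potential Δ D {i} {j} i≤n j≤Δ =
  trans (prefixSum-lookup j _ _ (potential-lookup D Δ i≤n) j≤Δ) (∑<-above i (later D i) j)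

potential-≥⇒majorized : ∀ Δ {n₁ n₂} (D₁ : Dag n₁) (D₂ : Dag n₂) {m i} → m ≤ n₁ → i ≤ n₂ →
  (∀ x → x < m → later D₁ m x ≤ Δ) → (∀ x → x < i → later D₂ i x ≤ Δ) →
  ω (potential Δ D₁ m) ≡ ω (potential Δ D₂ i) → potential Δ D₁ m ≥P potential Δ D₂ i →
  Majorized m (later D₁ m) i (later D₂ i)
potential-≥⇒majorized Δ D₁ D₂ {m} {i} m≤n₁ i≤n₂ c≤Δ e≤Δ ω≡ dominates =
  capped-≥⇒majorized c≤Δ e≤Δ cappedΔ≡ capped≥
  where
  cappedΔ≡ : capped m (later D₁ m) Δ ≡ capped i (later D₂ i) Δ
  cappedΔ≡ = begin
    capped m (later D₁ m) Δ         ≡⟨ sym (prefixSum-potential Δ D₁ m≤n₁ ≤-refl) ⟩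
    prefixSum Δ (potential Δ D₁ m) ≡⟨ sym (ω≡prefixSum (potential Δ D₁ m)) ⟩
    ω (potential Δ D₁ m)           ≡⟨ ω≡ ⟩
    ω (potential Δ D₂ i)           ≡⟨ ω≡prefixSum (potential Δ D₂ i) ⟩
    prefixSum Δ (potential Δ D₂ i) ≡⟨ prefixSum-potential Δ D₂ i≤n₂ ≤-refl ⟩
    capped i (later D₂ i) Δ         ∎
    where open ≡-Reasoning
  capped≥ : ∀ j → 1 ≤ j → j ≤ Δ → capped i (later D₂ i) j ≤ capped m (later D₁ m) j
  capped≥ j 1≤j j≤Δ = subst₂ _≤_ (prefixSum-potential Δ D₂ i≤n₂ j≤Δ) (prefixSum-potential Δ D₁ m≤n₁ j≤Δ)
                                  (dominates j 1≤j j≤Δ)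

-- Splicing

-- Positions below m carry the partial ordering; position m + z carries the old position i + z,
-- and B provides the arcs from the former to the latter.
module Glued (m : ℕ) (A₁ B A₂ : ℕ → ℕ → Bool) (i : ℕ) where
  arcs : ℕ → ℕ → Bool
  arcs x y =
    if x <ᵇ m
    then (if y <ᵇ m then A₁ x y else B x (y ∸ m))
    else (if y <ᵇ m then false else A₂ (i + (x ∸ m)) (i + (y ∸ m)))

  arcs-forward : Forward A₁ → Forward A₂ → Forward arcs
  arcs-forward fwd₁ fwd₂ x y arc with x <ᵇ m in x<ᵇm | y <ᵇ m in y<ᵇm
  ... | true  | true  = fwd₁ x y arc
  ... | true  | false = <-≤-trans (<ᵇ≡true⇒< {x} {m} x<ᵇm) (<ᵇ≡false⇒≥ {y} {m} y<ᵇm)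
  ... | false | false = subst₂ _<_ (m+[n∸m]≡n (<ᵇ≡false⇒≥ {x} {m} x<ᵇm))
                                   (m+[n∸m]≡n (<ᵇ≡false⇒≥ {y} {m} y<ᵇm))
                          (+-monoʳ-< m (+-cancelˡ-< i (x ∸ m) (y ∸ m) (fwd₂ _ _ arc)))

  low-low : ∀ {x y} → x < m → y < m → arcs x y ≡ A₁ x y
  low-low x<m y<m rewrite <⇒<ᵇ≡true x<m | <⇒<ᵇ≡true y<m = refl

  low-high : ∀ {x} z → x < m → arcs x (m + z) ≡ B x z
  low-high z x<m rewrite <⇒<ᵇ≡true x<m | ≥⇒<ᵇ≡false (m≤m+n m z) | m+n∸m≡n m z = refl

  high-low : ∀ z {y} → y < m → arcs (m + z) y ≡ false
  high-low z y<m rewrite ≥⇒<ᵇ≡false (m≤m+n m z) | <⇒<ᵇ≡true y<m = refl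

  high-high : ∀ z z′ → arcs (m + z) (m + z′) ≡ A₂ (i + z) (i + z′)
  high-high z z′
    rewrite ≥⇒<ᵇ≡false (m≤m+n m z) | ≥⇒<ᵇ≡false (m≤m+n m z′) | m+n∸m≡n m z | m+n∸m≡n m z′ = refl

module _ (L₁ X L₂ : List Deg) {A₁ A₂ B : ℕ → ℕ → Bool} {i : ℕ}
         (fwd₁ : Forward A₁) (fwd₂ : Forward A₂)
         (real₁ : RealizesBy (L₁ ++ X) A₁) (real₂ : RealizesBy L₂ A₂) (i≤n₂ : i ≤ length L₂)
         (rows : ∀ x → x < length L₁ →
                 count< (length L₂ ∸ i) (B x) ≡ laterℕ (length (L₁ ++ X)) A₁ (length L₁) x)
         (cols : ∀ z → z < length L₂ ∸ i →
                 count< (length L₁) (λ x → B x z) ≡ count< i (λ y → A₂ y (i + z)))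
  where
  private
    m n₁ n₂ t : ℕ
    m  = length L₁
    n₁ = length (L₁ ++ X)
    n₂ = length L₂
    t  = n₂ ∸ i
    L : List Deg
    L = L₁ ++ drop i L₂
    n : ℕ
    n = length L
    open Glued m A₁ B A₂ i

    m≤n₁ : m ≤ n₁
    m≤n₁ = subst (m ≤_) (sym (length-++ L₁)) (m≤m+n m _)

    n≡m+t : n ≡ m + t
    n≡m+t = trans (length-++ L₁) (cong (m +_) (length-drop i L₂))

    count<-L : ∀ f → count< n f ≡ count< m f + count< t (λ z → f (m + z))
    count<-L f = trans (cong (λ k → count< k f) n≡m+t) (∑<-split m t _)

    realizes-low : ∀ x → x < m → entry L x ≡ (count< n (λ y → arcs y x) , count< n (arcs x))
    realizes-low x x<m = begin
      entry L x                                        ≡⟨ entry-++ˡ L₁ _ x<m ⟩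
      entry L₁ x                                       ≡⟨ sym (entry-++ˡ L₁ X x<m) ⟩
      entry (L₁ ++ X) x                                ≡⟨ real₁ x (<-≤-trans x<m m≤n₁) ⟩
      (count< n₁ (λ y → A₁ y x) , count< n₁ (A₁ x))   ≡⟨ cong₂ _,_ in≡ out≡ ⟩
      (count< n (λ y → arcs y x) , count< n (arcs x)) ∎
      where
      open ≡-Reasoning
      in≡ : count< n₁ (λ y → A₁ y x) ≡ count< n (λ y → arcs y x)
      in≡ = begin
        count< n₁ (λ y → A₁ y x)
          ≡⟨ ∑<-split-≤ m≤n₁ _ ⟩
        count< m (λ y → A₁ y x) + count< (n₁ ∸ m) (λ u → A₁ (m + u) x)
          ≡⟨ cong (count< m (λ y → A₁ y x) +_) (count<-none (n₁ ∸ m) λ u _ →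
               Forward⇒no-backward-arc fwd₁ (≤-trans (<⇒≤ x<m) (m≤m+n m u))) ⟩
        count< m (λ y → A₁ y x) + 0
          ≡⟨ cong₂ _+_ (count<-cong m λ y y<m → sym (low-low y<m x<m))
                       (sym (count<-none t λ z _ → high-low z x<m)) ⟩
        count< m (λ y → arcs y x) + count< t (λ z → arcs (m + z) x)
          ≡⟨ sym (count<-L _) ⟩
        count< n (λ y → arcs y x) ∎
      out≡ : count< n₁ (A₁ x) ≡ count< n (arcs x)
      out≡ = begin
        count< n₁ (A₁ x)
          ≡⟨ outdegree-split fwd₁ m≤n₁ x<m ⟩
        count< m (A₁ x) + laterℕ n₁ A₁ m x
          ≡⟨ cong₂ _+_ (count<-cong m λ y y<m → sym (low-low x<m y<m))
                       (sym (trans (count<-cong t λ z _ → low-high z x<m) (rows x x<m))) ⟩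
        count< m (arcs x) + count< t (λ z → arcs x (m + z))
          ≡⟨ sym (count<-L _) ⟩
        count< n (arcs x) ∎

    realizes-high : ∀ z → z < t →
                    entry L (m + z) ≡ (count< n (λ y → arcs y (m + z)) , count< n (arcs (m + z)))
    realizes-high z z<t = begin
      entry L (m + z)                                              ≡⟨ entry-++ʳ L₁ _ z ⟩
      entry (drop i L₂) z                                          ≡⟨ entry-drop i L₂ z ⟩
      entry L₂ (i + z)                                             ≡⟨ real₂ (i + z) i+z<n₂ ⟩
      (count< n₂ (λ y → A₂ y (i + z)) , count< n₂ (A₂ (i + z)))   ≡⟨ cong₂ _,_ in≡ out≡ ⟩
      (count< n (λ y → arcs y (m + z)) , count< n (arcs (m + z))) ∎
      where
      open ≡-Reasoning
      i+z<n₂ : i + z < n₂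
      i+z<n₂ = subst (i + z <_) (m+[n∸m]≡n i≤n₂) (+-monoʳ-< i z<t)
      in≡ : count< n₂ (λ y → A₂ y (i + z)) ≡ count< n (λ y → arcs y (m + z))
      in≡ = begin
        count< n₂ (λ y → A₂ y (i + z))
          ≡⟨ ∑<-split-≤ i≤n₂ _ ⟩
        count< i (λ y → A₂ y (i + z)) + count< t (λ z′ → A₂ (i + z′) (i + z))
          ≡⟨ cong₂ _+_ (sym (trans (count<-cong m λ y y<m → low-high z y<m) (cols z z<t)))
                       (sym (count<-cong t λ z′ _ → high-high z′ z)) ⟩
        count< m (λ y → arcs y (m + z)) + count< t (λ z′ → arcs (m + z′) (m + z))
          ≡⟨ sym (count<-L _) ⟩
        count< n (λ y → arcs y (m + z)) ∎
      out≡ : count< n₂ (A₂ (i + z)) ≡ count< n (arcs (m + z))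
      out≡ = begin
        count< n₂ (A₂ (i + z))
          ≡⟨ ∑<-split-≤ i≤n₂ _ ⟩
        count< i (A₂ (i + z)) + count< t (λ z′ → A₂ (i + z) (i + z′))
          ≡⟨ cong₂ _+_ (trans (count<-none i λ y y<i →
                                 Forward⇒no-backward-arc fwd₂ (≤-trans (<⇒≤ y<i) (m≤m+n i z)))
                              (sym (count<-none m λ y y<m → high-low z y<m)))
                       (sym (count<-cong t λ z′ _ → high-high z z′)) ⟩
        count< m (arcs (m + z)) + count< t (λ z′ → arcs (m + z) (m + z′))
          ≡⟨ sym (count<-L _) ⟩
        count< n (arcs (m + z)) ∎

  glue-realizes : RealizesBy (L₁ ++ drop i L₂) (Glued.arcs m A₁ B A₂ i)
  glue-realizes x x<n with x <? m
  ... | yes x<m = realizes-low x x<m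
  ... | no  x≮m = subst (λ y → entry L y ≡ (count< n (λ y′ → arcs y′ y) , count< n (arcs y)))
                        (m+[n∸m]≡n m≤x) (realizes-high (x ∸ m) x∸m<t)
    where
    m≤x : m ≤ x
    m≤x = ≮⇒≥ x≮m
    x∸m<t : x ∸ m < t
    x∸m<t = +-cancelˡ-< m _ _ (subst₂ _<_ (sym (m+[n∸m]≡n m≤x)) n≡m+t x<n)

replace-prefix : ∀ {S'} (φ' X φ : List Deg) → φ' ↭ S' →
  (D' : Dag (length (φ' ++ X))) → Realizes (φ' ++ X) D' → (D : Dag (length φ)) → Realizes φ D →
  ∀ {i} → i ≤ length φ → Majorized (length φ') (later D' (length φ')) i (later D i) →
  RTO (S' ++ drop i φ) (φ' ++ drop i φ)
replace-prefix φ' X φ φ'↭S' D' real' D real {i} i≤n majorized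
  with realize-majorized (length φ ∸ i) (λ x z → arcℕ D x (i + z))
         (Majorized-congʳ (λ x x<i → laterℕ≡forwardArcs (arcℕ-forward D) i≤n x<i) majorized)
... | B , rows , cols =
  ++⁺ʳ (drop i φ) φ'↭S' , dagℕ _ glued glued-forward ,
  RealizesBy⇒Realizes (φ' ++ drop i φ) glued glued-forward
    (glue-realizes φ' X φ (arcℕ-forward D') (arcℕ-forward D)
       (Realizes⇒RealizesBy (φ' ++ X) D' real') (Realizes⇒RealizesBy φ D real) i≤n rows cols)
  where
  open Glued (length φ') (arcℕ D') B (arcℕ D) i
    renaming (arcs to glued)
  glued-forward : Forward glued
  glued-forward = arcs-forward (arcℕ-forward D') (arcℕ-forward D)

lemma6 : (Δ : ℕ) → 1 ≤ Δ →
    (S S' : DegSeq) → Bounded Δ S → Bounded Δ S' →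
    (φ : List Deg) → φ ↭ S →
    (D : Dag (length φ)) → Realizes φ D →
    (i : ℕ) → 1 ≤ i → i ≤ length φ →
    (φ' : List Deg) (p : Vec ℕ Δ) →
    PTO Δ S' (zeroV Δ) p φ' →
    ω p ≡ ω (potential Δ D i) →
    p ≥P potential Δ D i →
    RTO (S' ++ drop i φ) (φ' ++ drop i φ)
-- Matching Δ on suc lets first (zeroV Δ) reduce to 0, which forces Pˢ = [].
lemma6 Δ@(suc _) _ _ S' bounded bounded' φ φ↭S D real i _ i≤n φ' p
       ([] , _ , α , α↭[] , perm , D' , real' , potential≡p) ω≡ dominates
  with refl ← ↭-empty-inv α↭[] = replace-prefix φ' (Pt p) φ φ'↭S' D' real' D real i≤n
    (potential-≥⇒majorized Δ D' D m≤n' i≤n later'≤Δ later≤Δ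
      (subst (λ v → ω v ≡ ω (potential Δ D i)) p≡ ω≡) (subst (_≥P potential Δ D i) p≡ dominates))
  where
  φ'↭S' : φ' ↭ S'
  φ'↭S' = ++-cancelʳ (Pt p) perm
  m : ℕ
  m = length φ'
  m≤n' : m ≤ length (φ' ++ Pt p)
  m≤n' = subst (m ≤_) (sym (length-++ φ')) (m≤m+n m _)
  p≡ : p ≡ potential Δ D' m
  p≡ = sym (subst (λ k → potential Δ D' k ≡ p) (sym (↭-length φ'↭S')) potential≡p)
  later'≤Δ : ∀ x → x < m → later D' m x ≤ Δ
  later'≤Δ x x<m = ≤-trans (later-≤-outdegree (φ' ++ Pt p) D' real' m≤n' x<m)
    (subst (_≤ Δ) (cong proj₂ (sym (entry-++ˡ φ' (Pt p) x<m))) (Bounded⇒outdegree≤ bounded' φ'↭S' x<m))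
  later≤Δ : ∀ x → x < i → later D i x ≤ Δ
  later≤Δ x x<i = ≤-trans (later-≤-outdegree φ D real i≤n x<i)
                          (Bounded⇒outdegree≤ bounded φ↭S (<-≤-trans x<i i≤n))
lemma6 (suc _) _ _ _ _ _ _ _ _ _ _ _ _ _ _ ((_ ∷ _) , (() , _) , _) _ _
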